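{- Let $M$ be a matroid on $T$ with rank function $\operatorname{rk}$, and let $M_1,M_2$ be extensions of $M$ with ground sets $E_1,E_2$ and rank functions $\operatorname{rk}_1,\operatorname{rk}_2$, where $E_1\cap E_2=T$, $E=E_1\cup E_2$, and all these matroids have finite rank and finite or countably infinite ground sets. Define $\eta,\xi$ and $\mathcal{L}(M_1,M_2)$ as below. Assume that for every pair $(X,Y)$ of elements of $\mathcal{L}(M_1,M_2)$, at least one of $f=\eta$ or $f=\xi$ satisfies $f(X)+f(Y)\ge f(X\cap Y)+f(X\cup Y)$. Then $\xi$ is submodular on all subsets of $E$, and the proper amalgam of $M_1$ and $M_2$ along $M$ exists.
   Context: For $X\subseteq E$: $\eta(X)=\operatorname{rk}_1(X\cap E_1)+\operatorname{rk}_2(X\cap E_2)-\operatorname{rk}(X\cap T)$ and $\xi(X)=\min\{\eta(Y): X\subseteq Y\subseteq E\}$. $\mathcal{L}(M_1,M_2)$ is the set of all $X\subseteq E$ such that $X\cap E_1$ is a flat of $M_1$ and $X\cap E_2$ is a flat of $M_2$. When $\xi$ is submodular it is the rank function of a matroid on $E$ whose restriction to $E_i$ is $M_i$; this matroid is called the proper amalgam. -}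

module Defs where

open import Level using (0ℓ)
open import Data.Nat using (ℕ; zero; suc; _+_; _∸_; _≤_; _<_)
open import Data.Product using (Σ; ∃; _×_; _,_)
open import Data.Sum using (_⊎_)
open import Data.List using (List)
open import Data.List.Membership.Propositional using (_∈_)
open import Relation.Nullary using (¬_)
open import Relation.Binary.PropositionalEquality using (_≡_)
open import Function.Definitions using (Injective)
open import Relation.Unary using (Pred; _⊆_; _∩_; _∪_; ∅; ｛_｝)

Subset : Set → Set₁
Subset A = Pred A 0ℓ

fromList : {A : Set} → List A → Subset A
fromList xs x = x ∈ xs

-- The type A is finite or countably infinite: it injects into ℕ.
Countable : Set → Set
Countable A = Σ (A → ℕ) λ f → Injective _≡_ _≡_ f

-- r is the rank function of a (finitary) matroid of finite rank with
-- ground set S ⊆ A.  Only the values of r on subsets of S matter.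
record IsFiniteRankMatroid {A : Set} (S : Subset A) (r : Subset A → ℕ) : Set₁ where
  field
    rank-∅      : r ∅ ≡ 0
    rank-mono   : ∀ {X Y} → X ⊆ Y → Y ⊆ S → r X ≤ r Y
    rank-unit   : ∀ {X} x → X ⊆ S → S x → r (X ∪ ｛ x ｝) ≤ suc (r X)
    rank-submod : ∀ {X Y} → X ⊆ S → Y ⊆ S → r (X ∩ Y) + r (X ∪ Y) ≤ r X + r Y
    rank-finitary : ∀ {X} → X ⊆ S → ∃ λ (xs : List A) → fromList xs ⊆ X × r (fromList xs) ≡ r X
    rank-finite : ∃ λ (k : ℕ) → ∀ {X} → X ⊆ S → r X ≤ k

RestrictsTo : {A : Set} → (Subset A → ℕ) → Subset A → (Subset A → ℕ) → Set₁
RestrictsTo r' S r = ∀ X → X ⊆ S → r' X ≡ r X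

IsFlat : {A : Set} → Subset A → (Subset A → ℕ) → Subset A → Set
IsFlat S r F = F ⊆ S × (∀ x → S x → ¬ F x → r F < r (F ∪ ｛ x ｝))

SubmodPair : {A : Set} → (Subset A → ℕ) → Subset A → Subset A → Set
SubmodPair f X Y = f (X ∩ Y) + f (X ∪ Y) ≤ f X + f Y

-- Amalgamation set-up: E is the type of all elements, E₁ E₂ ⊆ E with E = E₁ ∪ E₂
-- and T = E₁ ∩ E₂.
module Amalgam {E : Set} (E₁ E₂ : Subset E) (rk rk₁ rk₂ : Subset E → ℕ) where

  T : Subset E
  T = E₁ ∩ E₂

  -- η(X) = rk₁(X∩E₁) + rk₂(X∩E₂) − rk(X∩T)   (the subtraction never truncates,
  -- since rk(X∩T) = rk₁(X∩T) ≤ rk₁(X∩E₁))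
  η : Subset E → ℕ
  η X = (rk₁ (X ∩ E₁) + rk₂ (X ∩ E₂)) ∸ rk (X ∩ T)

  -- ξ(X) = min { η(Y) : X ⊆ Y ⊆ E }, given by its defining property.
  IsXi : (Subset E → ℕ) → Set₁
  IsXi ξ = ∀ X → (∃ λ Y → X ⊆ Y × η Y ≡ ξ X) × (∀ Y → X ⊆ Y → ξ X ≤ η Y)

  InL : Subset E → Set
  InL X = IsFlat E₁ rk₁ (X ∩ E₁) × IsFlat E₂ rk₂ (X ∩ E₂)

-- The minimum ξ of η over supersets is attained on a member of 𝓛(M₁,M₂): closing a set
-- in M₁ and then in M₂ never increases η, and the bounded quantity rk₁ + rk₂ grows until
-- both parts are flats.  Comparing ξ with η on such minimisers turns either inequality
-- of the hypothesis into submodularity of ξ.  The remaining rank axioms for ξ are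
-- inherited from η: adding one element of Eᵢ raises η by at most one, and an element
-- spanned in Mᵢ by a finite subset does not raise it at all.
module Submission where

open import Defs
open import Data.Nat using (ℕ; zero; suc; _+_; _∸_; _≤_; _<_)
open import Data.Nat.Properties
open import Data.Nat.Tactic.RingSolver using (solve-∀)
open import Data.Product using (_×_; _,_; proj₁; proj₂; Σ; ∃; swap)
open import Data.Sum using (_⊎_; inj₁; inj₂; [_,_]; map)
open import Data.List using (List; []; _∷_; _++_)
open import Data.List.Membership.Propositional.Properties using (∈-++⁺ˡ; ∈-++⁺ʳ; ∈-++⁻)
open import Data.List.Relation.Unary.Any using (here; there)
open import Data.Empty using (⊥-elim)
open import Relation.Nullary using (¬_; yes; no)
open import Relation.Binary.PropositionalEquality using (_≡_; refl; sym; trans; cong; cong₂; subst; subst₂; module ≡-Reasoning)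
open import Relation.Unary using (U; _⊆_; _∩_; _∪_; ∅; ｛_｝)

∸-≤-∸ : ∀ {b b' c c'} → c ≤ b → b' + c ≤ b + c' → b' ∸ c' ≤ b ∸ c
∸-≤-∸ {b} {b'} {c} {c'} c≤b le = m≤n+o⇒m∸n≤o b' c' (+-cancelʳ-≤ c b' _ (begin
  b' + c                    ≤⟨ le ⟩
  b + c'                    ≡⟨ cong (_+ c') (sym (m∸n+n≡m c≤b)) ⟩
  (b ∸ c + c) + c'          ≡⟨ rearrange (b ∸ c) c c' ⟩
  (c' + (b ∸ c)) + c        ∎))
  where
  open ≤-Reasoning
  rearrange : ∀ d c c' → (d + c) + c' ≡ (c' + d) + c
  rearrange = solve-∀

module Closure {A : Set} {S : Subset A} {r : Subset A → ℕ} (M : IsFiniteRankMatroid S r) where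
  open IsFiniteRankMatroid M

  closure : Subset A → Subset A
  closure Z x = S x × r (Z ∪ ｛ x ｝) ≤ r Z

  ∪-singleton-⊆ : ∀ {Z : Subset A} {x} → Z ⊆ S → S x → Z ∪ ｛ x ｝ ⊆ S
  ∪-singleton-⊆ Z⊆S x∈S = [ Z⊆S , (λ { refl → x∈S }) ]

  ⊆-closure : ∀ {Z} → Z ⊆ S → Z ⊆ closure Z
  ⊆-closure Z⊆S z∈Z = Z⊆S z∈Z , rank-mono [ (λ z → z) , (λ { refl → z∈Z }) ] Z⊆S

  rank-∪-absorb : ∀ {Z V W} → Z ⊆ W → Z ⊆ V → W ⊆ S → V ⊆ S → r V ≤ r Z → r (W ∪ V) ≤ r W
  rank-∪-absorb {Z} {V} {W} Z⊆W Z⊆V W⊆S V⊆S rV≤rZ = +-cancelʳ-≤ (r Z) _ _ (begin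
    r (W ∪ V) + r Z        ≤⟨ +-monoʳ-≤ (r (W ∪ V)) (rank-mono (λ z → Z⊆W z , Z⊆V z) (λ p → W⊆S (proj₁ p))) ⟩
    r (W ∪ V) + r (W ∩ V)  ≡⟨ +-comm (r (W ∪ V)) _ ⟩
    r (W ∩ V) + r (W ∪ V)  ≤⟨ rank-submod W⊆S V⊆S ⟩
    r W + r V              ≤⟨ +-monoʳ-≤ (r W) rV≤rZ ⟩
    r W + r Z              ∎)
    where open ≤-Reasoning

  rank-∪-fromList : ∀ {Z} xs → Z ⊆ S → fromList xs ⊆ closure Z → r (Z ∪ fromList xs) ≤ r Z
  rank-∪-fromList [] Z⊆S _ = rank-mono [ (λ z → z) , (λ ()) ] Z⊆S
  rank-∪-fromList {Z} (x ∷ xs) Z⊆S xs⊆cl = begin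
    r (Z ∪ fromList (x ∷ xs))           ≤⟨ rank-mono split [ W⊆S , V⊆S ] ⟩
    r (W ∪ V)                           ≤⟨ rank-∪-absorb inj₁ inj₁ W⊆S V⊆S (proj₂ x∈cl) ⟩
    r W                                 ≤⟨ rank-∪-fromList xs Z⊆S (λ m → xs⊆cl (there m)) ⟩
    r Z                                 ∎
    where
    open ≤-Reasoning
    W = Z ∪ fromList xs
    V = Z ∪ ｛ x ｝
    x∈cl = xs⊆cl (here refl)
    W⊆S : W ⊆ S
    W⊆S = [ Z⊆S , (λ m → proj₁ (xs⊆cl (there m))) ]
    V⊆S : V ⊆ S
    V⊆S = ∪-singleton-⊆ Z⊆S (proj₁ x∈cl)
    split : Z ∪ fromList (x ∷ xs) ⊆ W ∪ V
    split (inj₁ z) = inj₁ (inj₁ z)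
    split (inj₂ (here refl)) = inj₂ (inj₂ refl)
    split (inj₂ (there m)) = inj₁ (inj₂ m)

  rank-closure : ∀ {Z} → Z ⊆ S → r (closure Z) ≤ r Z
  rank-closure {Z} Z⊆S with rank-finitary {closure Z} proj₁
  ... | xs , xs⊆cl , r-xs≡ = begin
    r (closure Z)         ≡⟨ sym r-xs≡ ⟩
    r (fromList xs)       ≤⟨ rank-mono inj₂ [ Z⊆S , (λ m → proj₁ (xs⊆cl m)) ] ⟩
    r (Z ∪ fromList xs)   ≤⟨ rank-∪-fromList xs Z⊆S xs⊆cl ⟩
    r Z                   ∎
    where open ≤-Reasoning

  rank≤⇒closure-⊆ : ∀ {Z W} → Z ⊆ W → W ⊆ S → r W ≤ r Z → closure W ⊆ closure Z
  rank≤⇒closure-⊆ {Z} {W} Z⊆W W⊆S rW≤rZ {x} (x∈S , rWx≤rW) = x∈S , (begin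
    r (Z ∪ ｛ x ｝)   ≤⟨ rank-mono [ (λ z → inj₁ (Z⊆W z)) , inj₂ ] (∪-singleton-⊆ W⊆S x∈S) ⟩
    r (W ∪ ｛ x ｝)   ≤⟨ rWx≤rW ⟩
    r W              ≤⟨ rW≤rZ ⟩
    r Z              ∎)
    where open ≤-Reasoning

  closed⇒flat : ∀ {F} → F ⊆ S → closure F ⊆ F → IsFlat S r F
  closed⇒flat {F} F⊆S closed = F⊆S , grows
    where
    grows : ∀ x → S x → ¬ F x → r F < r (F ∪ ｛ x ｝)
    grows x x∈S x∉F with r F <? r (F ∪ ｛ x ｝)
    ... | yes lt = lt
    ... | no ≮ = ⊥-elim (x∉F (closed (x∈S , ≮⇒≥ ≮)))

module Side {E : Set} (E₁ E₂ : Subset E) (rk rk₁ rk₂ : Subset E → ℕ)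
  (M₁ : IsFiniteRankMatroid E₁ rk₁) (M₂ : IsFiniteRankMatroid E₂ rk₂)
  (rk₂↾T : RestrictsTo rk₂ (E₁ ∩ E₂) rk)
  where
  open Amalgam E₁ E₂ rk rk₁ rk₂ public
  module M₁ = IsFiniteRankMatroid M₁
  module M₂ = IsFiniteRankMatroid M₂
  open Closure M₁ using (closure; ⊆-closure; rank-closure; rank≤⇒closure-⊆; closed⇒flat)

  excess : Subset E → ℕ
  excess X = rk₂ (X ∩ E₂) ∸ rk (X ∩ T)

  rk-T≤rk₂ : ∀ X → rk (X ∩ T) ≤ rk₂ (X ∩ E₂)
  rk-T≤rk₂ X = subst (_≤ rk₂ (X ∩ E₂)) (rk₂↾T (X ∩ T) proj₂)
                 (M₂.rank-mono (λ (x , _ , x∈E₂) → x , x∈E₂) proj₂)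

  η≡rk₁+excess : ∀ X → η X ≡ rk₁ (X ∩ E₁) + excess X
  η≡rk₁+excess X = +-∸-assoc (rk₁ (X ∩ E₁)) (rk-T≤rk₂ X)

  rk₁≤η : ∀ {X Y} → X ⊆ E₁ → X ⊆ Y → rk₁ X ≤ η Y
  rk₁≤η {X} {Y} X⊆E₁ X⊆Y = begin
    rk₁ X                       ≤⟨ M₁.rank-mono (λ x → X⊆Y x , X⊆E₁ x) proj₂ ⟩
    rk₁ (Y ∩ E₁)                ≤⟨ m≤m+n _ _ ⟩
    rk₁ (Y ∩ E₁) + excess Y     ≡⟨ sym (η≡rk₁+excess Y) ⟩
    η Y                         ∎
    where open ≤-Reasoning

  η≡rk₁ : ∀ X → X ⊆ E₁ → η X ≡ rk₁ X
  η≡rk₁ X X⊆E₁ = begin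
    η X                                    ≡⟨ η≡rk₁+excess X ⟩
    rk₁ (X ∩ E₁) + excess X                ≡⟨ cong₂ _+_ rk₁-X∩E₁ excess≡0 ⟩
    rk₁ X + 0                              ≡⟨ +-identityʳ (rk₁ X) ⟩
    rk₁ X                                  ∎
    where
    open ≡-Reasoning
    rk₁-X∩E₁ : rk₁ (X ∩ E₁) ≡ rk₁ X
    rk₁-X∩E₁ = ≤-antisym (M₁.rank-mono proj₁ X⊆E₁) (M₁.rank-mono (λ x → x , X⊆E₁ x) proj₂)
    rk₂-X∩E₂ : rk₂ (X ∩ E₂) ≡ rk (X ∩ T)
    rk₂-X∩E₂ = ≤-antisym
      (subst (rk₂ (X ∩ E₂) ≤_) (rk₂↾T (X ∩ T) proj₂)
        (M₂.rank-mono (λ (x , x∈E₂) → x , X⊆E₁ x , x∈E₂) (λ (_ , _ , x∈E₂) → x∈E₂)))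
      (rk-T≤rk₂ X)
    excess≡0 : excess X ≡ 0
    excess≡0 = trans (cong (_∸ rk (X ∩ T)) rk₂-X∩E₂) (n∸n≡0 (rk (X ∩ T)))

  -- Submodularity of rk₂ on Y ∩ E₂ and (Y ∪ A) ∩ T.
  excess-∪ : ∀ Y {A} → A ⊆ E₁ → excess (Y ∪ A) ≤ excess Y
  excess-∪ Y {A} A⊆E₁ = ∸-≤-∸ (rk-T≤rk₂ Y) (begin
    rk₂ ((Y ∪ A) ∩ E₂) + rk (Y ∩ T)     ≤⟨ +-mono-≤ (M₂.rank-mono split [ proj₂ , (λ (_ , _ , x∈E₂) → x∈E₂) ])
                                                      (subst (_≤ rk₂ (Y₂ ∩ C)) (rk₂↾T (Y ∩ T) proj₂)
                                                        (M₂.rank-mono meet (λ ((_ , x∈E₂) , _) → x∈E₂))) ⟩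
    rk₂ (Y₂ ∪ C) + rk₂ (Y₂ ∩ C)         ≡⟨ +-comm (rk₂ (Y₂ ∪ C)) _ ⟩
    rk₂ (Y₂ ∩ C) + rk₂ (Y₂ ∪ C)         ≤⟨ M₂.rank-submod proj₂ (λ (_ , _ , x∈E₂) → x∈E₂) ⟩
    rk₂ Y₂ + rk₂ C                      ≡⟨ cong (rk₂ Y₂ +_) (rk₂↾T C proj₂) ⟩
    rk₂ Y₂ + rk C                       ∎)
    where
    open ≤-Reasoning
    Y₂ = Y ∩ E₂
    C = (Y ∪ A) ∩ T
    split : (Y ∪ A) ∩ E₂ ⊆ Y₂ ∪ C
    split (inj₁ y , x∈E₂) = inj₁ (y , x∈E₂)
    split (inj₂ a , x∈E₂) = inj₂ (inj₂ a , A⊆E₁ a , x∈E₂)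
    meet : Y ∩ T ⊆ Y₂ ∩ C
    meet (y , x∈E₁ , x∈E₂) = (y , x∈E₂) , (inj₁ y , x∈E₁ , x∈E₂)

  η-∪ : ∀ Y {A} k → A ⊆ E₁ → rk₁ ((Y ∪ A) ∩ E₁) ≤ k + rk₁ (Y ∩ E₁) → η (Y ∪ A) ≤ k + η Y
  η-∪ Y {A} k A⊆E₁ rk₁-grows = begin
    η (Y ∪ A)                              ≡⟨ η≡rk₁+excess (Y ∪ A) ⟩
    rk₁ ((Y ∪ A) ∩ E₁) + excess (Y ∪ A)    ≤⟨ +-mono-≤ rk₁-grows (excess-∪ Y A⊆E₁) ⟩
    (k + rk₁ (Y ∩ E₁)) + excess Y          ≡⟨ +-assoc k _ _ ⟩
    k + (rk₁ (Y ∩ E₁) + excess Y)          ≡⟨ cong (k +_) (sym (η≡rk₁+excess Y)) ⟩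
    k + η Y                                ∎
    where open ≤-Reasoning

  η-∪-singleton : ∀ Y {x} → E₁ x → η (Y ∪ ｛ x ｝) ≤ suc (η Y)
  η-∪-singleton Y {x} x∈E₁ = η-∪ Y 1 (λ { refl → x∈E₁ })
    (≤-trans (M₁.rank-mono split (Closure.∪-singleton-⊆ M₁ {Y ∩ E₁} proj₂ x∈E₁)) (M₁.rank-unit x proj₂ x∈E₁))
    where
    split : (Y ∪ ｛ x ｝) ∩ E₁ ⊆ (Y ∩ E₁) ∪ ｛ x ｝
    split (inj₁ y , x∈E₁) = inj₁ (y , x∈E₁)
    split (inj₂ refl , _) = inj₂ refl

  η-∪-spanned : ∀ Y {A L} → A ⊆ E₁ → L ⊆ Y → L ⊆ A → rk₁ A ≤ rk₁ L → η (Y ∪ A) ≤ η Y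
  η-∪-spanned Y {A} A⊆E₁ L⊆Y L⊆A rkA≤rkL = η-∪ Y 0 A⊆E₁
    (≤-trans (M₁.rank-mono split [ proj₂ , A⊆E₁ ])
      (Closure.rank-∪-absorb M₁ {W = Y ∩ E₁} (λ l → L⊆Y l , A⊆E₁ (L⊆A l)) L⊆A proj₂ A⊆E₁ rkA≤rkL))
    where
    split : (Y ∪ A) ∩ E₁ ⊆ (Y ∩ E₁) ∪ A
    split (inj₁ y , x∈E₁) = inj₁ (y , x∈E₁)
    split (inj₂ a , _) = inj₂ a

  cl : Subset E → Subset E
  cl Y = closure (Y ∩ E₁)

  rk₁-∪-cl : ∀ Y → rk₁ ((Y ∪ cl Y) ∩ E₁) ≤ rk₁ (Y ∩ E₁)
  rk₁-∪-cl Y = ≤-trans (M₁.rank-mono into-cl proj₁) (rank-closure proj₂)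
    where
    into-cl : (Y ∪ cl Y) ∩ E₁ ⊆ cl Y
    into-cl (inj₁ y , x∈E₁) = ⊆-closure proj₂ (y , x∈E₁)
    into-cl (inj₂ c , _) = c

  η-∪-cl : ∀ Y → η (Y ∪ cl Y) ≤ η Y
  η-∪-cl Y = η-∪ Y 0 proj₁ (rk₁-∪-cl Y)

  flat-if-rank-stable : ∀ Y W → Y ∪ cl Y ⊆ W → rk₁ (W ∩ E₁) ≤ rk₁ (Y ∩ E₁) → IsFlat E₁ rk₁ (W ∩ E₁)
  flat-if-rank-stable Y W Y∪cl⊆W rk-stable = closed⇒flat proj₂ λ c →
    let c' = rank≤⇒closure-⊆ (λ (y , x∈E₁) → Y∪cl⊆W (inj₁ y) , x∈E₁) proj₂ rk-stable c
    in Y∪cl⊆W (inj₂ c') , proj₁ c'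

module Amalgamation {E : Set} (E₁ E₂ : Subset E) (rk rk₁ rk₂ : Subset E → ℕ)
  (cover : ∀ x → E₁ x ⊎ E₂ x)
  (M : IsFiniteRankMatroid (E₁ ∩ E₂) rk)
  (M₁ : IsFiniteRankMatroid E₁ rk₁)
  (M₂ : IsFiniteRankMatroid E₂ rk₂)
  (rk₁↾T : RestrictsTo rk₁ (E₁ ∩ E₂) rk)
  (rk₂↾T : RestrictsTo rk₂ (E₁ ∩ E₂) rk)
  (ξ : Subset E → ℕ)
  (isξ : Amalgam.IsXi E₁ E₂ rk rk₁ rk₂ ξ)
  where
  module S₁ = Side E₁ E₂ rk rk₁ rk₂ M₁ M₂ rk₂↾T
  module S₂ = Side E₂ E₁ rk rk₂ rk₁ M₂ M₁ (λ X X⊆T → rk₁↾T X (λ x → swap (X⊆T x)))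
  module M₁ = IsFiniteRankMatroid M₁
  module M₂ = IsFiniteRankMatroid M₂
  open S₁ using (η; InL)

  η-swap : ∀ X → S₂.η X ≡ η X
  η-swap X = cong₂ _∸_ (+-comm (rk₂ (X ∩ E₂)) _)
    (≤-antisym (rank-mono (λ (x , e) → x , swap e) proj₂)
               (rank-mono (λ (x , e) → x , swap e) (λ (_ , e) → swap e)))
    where open IsFiniteRankMatroid M

  η₂≤⇒η≤ : ∀ {X Y} k → S₂.η X ≤ k + S₂.η Y → η X ≤ k + η Y
  η₂≤⇒η≤ {X} {Y} k = subst₂ (λ a b → a ≤ k + b) (η-swap X) (η-swap Y)

  ξ≤η : ∀ {X Y} → X ⊆ Y → ξ X ≤ η Y
  ξ≤η {X} {Y} = proj₂ (isξ X) Y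

  ξ-mono : ∀ {X Y} → X ⊆ Y → ξ X ≤ ξ Y
  ξ-mono {X} {Y} X⊆Y with proj₁ (isξ Y)
  ... | Y' , Y⊆Y' , ηY'≡ξY = subst (ξ X ≤_) ηY'≡ξY (ξ≤η (λ x → Y⊆Y' (X⊆Y x)))

  rank-sum : Subset E → ℕ
  rank-sum Y = rk₁ (Y ∩ E₁) + rk₂ (Y ∩ E₂)

  K : ℕ
  K = proj₁ M₁.rank-finite + proj₁ M₂.rank-finite

  rank-sum≤K : ∀ Y → rank-sum Y ≤ K
  rank-sum≤K Y = +-mono-≤ (proj₂ M₁.rank-finite proj₂) (proj₂ M₂.rank-finite proj₂)

  η≤K : ∀ Y → η Y ≤ K
  η≤K Y = ≤-trans (m∸n≤m (rank-sum Y) (rk (Y ∩ S₁.T))) (rank-sum≤K Y)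

  close₁ : Subset E → Subset E
  close₁ Y = Y ∪ S₁.cl Y

  close : Subset E → Subset E
  close Y = close₁ Y ∪ S₂.cl (close₁ Y)

  ⊆-close : ∀ {Y} → Y ⊆ close Y
  ⊆-close y = inj₁ (inj₁ y)

  η-close : ∀ Y → η (close Y) ≤ η Y
  η-close Y = ≤-trans (η₂≤⇒η≤ 0 (S₂.η-∪-cl (close₁ Y))) (S₁.η-∪-cl Y)

  -- The E₂-part of close Y is closed by construction; its E₁-part is closed once
  -- rank-sum stops growing, because rk₂ can only grow.
  close-∈𝓛 : ∀ Y → rank-sum (close Y) ≤ rank-sum Y → InL (close Y)
  close-∈𝓛 Y stable =
      S₁.flat-if-rank-stable Y (close Y) inj₁ rk₁-stable
    , S₂.flat-if-rank-stable (close₁ Y) (close Y) (λ y → y) (S₂.rk₁-∪-cl (close₁ Y))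
    where
    rk₂-grows : rk₂ (Y ∩ E₂) ≤ rk₂ (close Y ∩ E₂)
    rk₂-grows = M₂.rank-mono (λ (y , x∈E₂) → ⊆-close y , x∈E₂) proj₂
    rk₁-stable : rk₁ (close Y ∩ E₁) ≤ rk₁ (Y ∩ E₁)
    rk₁-stable = +-cancelʳ-≤ (rk₂ (Y ∩ E₂)) _ _ (≤-trans (+-monoʳ-≤ _ rk₂-grows) stable)

  -- Each unsuccessful round raises rank-sum ≤ K, so the fuel K + 1 suffices.
  𝓛-above-within : ∀ n Y → K < rank-sum Y + n → Σ (Subset E) λ Y' → Y ⊆ Y' × η Y' ≤ η Y × InL Y'
  𝓛-above-within zero Y K<Y = ⊥-elim (≤⇒≯ (subst (_≤ K) (sym (+-identityʳ _)) (rank-sum≤K Y)) K<Y)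
  𝓛-above-within (suc n) Y K<Y with rank-sum (close Y) ≤? rank-sum Y
  ... | yes stable = close Y , ⊆-close , η-close Y , close-∈𝓛 Y stable
  ... | no grows with 𝓛-above-within n (close Y)
                        (≤-trans K<Y (subst (_≤ rank-sum (close Y) + n) (sym (+-suc _ n))
                                       (+-monoˡ-≤ n (≰⇒> grows))))
  ...   | Y' , close⊆Y' , ηY'≤ , Y'∈𝓛 = Y' , (λ y → close⊆Y' (⊆-close y)) , ≤-trans ηY'≤ (η-close Y) , Y'∈𝓛

  ξ-attained-in-𝓛 : ∀ X → Σ (Subset E) λ Y → X ⊆ Y × η Y ≤ ξ X × InL Y
  ξ-attained-in-𝓛 X with proj₁ (isξ X)
  ... | Y , X⊆Y , ηY≡ξX with 𝓛-above-within (suc K) Y (m≤n+m (suc K) (rank-sum Y))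
  ...   | Y' , Y⊆Y' , ηY'≤ηY , Y'∈𝓛 = Y' , (λ x → Y⊆Y' (X⊆Y x)) , subst (η Y' ≤_) ηY≡ξX ηY'≤ηY , Y'∈𝓛

  ξ-submodular : (∀ X Y → InL X → InL Y → SubmodPair η X Y ⊎ SubmodPair ξ X Y)
               → ∀ X Y → SubmodPair ξ X Y
  ξ-submodular hyp X Y with ξ-attained-in-𝓛 X | ξ-attained-in-𝓛 Y
  ... | X' , X⊆X' , ηX'≤ξX , X'∈𝓛 | Y' , Y⊆Y' , ηY'≤ξY , Y'∈𝓛 = begin
    ξ (X ∩ Y) + ξ (X ∪ Y)     ≤⟨ bound (hyp X' Y' X'∈𝓛 Y'∈𝓛) ⟩
    η X' + η Y'               ≤⟨ +-mono-≤ ηX'≤ξX ηY'≤ξY ⟩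
    ξ X + ξ Y                 ∎
    where
    open ≤-Reasoning
    ∩-⊆ : X ∩ Y ⊆ X' ∩ Y'
    ∩-⊆ (x , y) = X⊆X' x , Y⊆Y' y
    ∪-⊆ : X ∪ Y ⊆ X' ∪ Y'
    ∪-⊆ = map X⊆X' Y⊆Y'
    bound : SubmodPair η X' Y' ⊎ SubmodPair ξ X' Y' → ξ (X ∩ Y) + ξ (X ∪ Y) ≤ η X' + η Y'
    bound (inj₁ η-submod) = ≤-trans (+-mono-≤ (ξ≤η ∩-⊆) (ξ≤η ∪-⊆)) η-submod
    bound (inj₂ ξ-submod) = ≤-trans (+-mono-≤ (ξ-mono ∩-⊆) (ξ-mono ∪-⊆))
                              (≤-trans ξ-submod (+-mono-≤ (ξ≤η (λ x → x)) (ξ≤η (λ y → y))))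

  ξ-∅ : ξ ∅ ≡ 0
  ξ-∅ = n≤0⇒n≡0 (begin
    ξ ∅                                  ≤⟨ ξ≤η (λ x → x) ⟩
    η ∅                                  ≤⟨ m∸n≤m (rank-sum ∅) (rk (∅ ∩ S₁.T)) ⟩
    rk₁ (∅ ∩ E₁) + rk₂ (∅ ∩ E₂)          ≤⟨ +-mono-≤ (M₁.rank-mono proj₁ λ ()) (M₂.rank-mono proj₁ λ ()) ⟩
    rk₁ ∅ + rk₂ ∅                        ≡⟨ cong₂ _+_ M₁.rank-∅ M₂.rank-∅ ⟩
    0                                    ∎)
    where open ≤-Reasoning

  η-∪-singleton : ∀ Y x → η (Y ∪ ｛ x ｝) ≤ suc (η Y)
  η-∪-singleton Y x with cover x
  ... | inj₁ x∈E₁ = S₁.η-∪-singleton Y x∈E₁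
  ... | inj₂ x∈E₂ = η₂≤⇒η≤ 1 (S₂.η-∪-singleton Y x∈E₂)

  ξ-∪-singleton : ∀ X x → ξ (X ∪ ｛ x ｝) ≤ suc (ξ X)
  ξ-∪-singleton X x with proj₁ (isξ X)
  ... | Y , X⊆Y , ηY≡ξX = begin
    ξ (X ∪ ｛ x ｝)      ≤⟨ ξ≤η (map X⊆Y (λ x → x)) ⟩
    η (Y ∪ ｛ x ｝)      ≤⟨ η-∪-singleton Y x ⟩
    suc (η Y)           ≡⟨ cong suc ηY≡ξX ⟩
    suc (ξ X)           ∎
    where open ≤-Reasoning

  -- X is covered by a minimiser Y of η over the union L of finite spanning lists of
  -- X ∩ E₁ and X ∩ E₂, enlarged by the spanned sets X ∩ E₁ and X ∩ E₂.
  ξ-finitary : ∀ X → ∃ λ (xs : List E) → fromList xs ⊆ X × ξ (fromList xs) ≡ ξ X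
  ξ-finitary X with M₁.rank-finitary {X ∩ E₁} proj₂ | M₂.rank-finitary {X ∩ E₂} proj₂
  ... | l₁ , l₁⊆ , rk-l₁ | l₂ , l₂⊆ , rk-l₂ = l₁ ++ l₂ , L⊆X , ≤-antisym (ξ-mono L⊆X) ξX≤ξL
    where
    L⊆X : fromList (l₁ ++ l₂) ⊆ X
    L⊆X m with ∈-++⁻ l₁ m
    ... | inj₁ m₁ = proj₁ (l₁⊆ m₁)
    ... | inj₂ m₂ = proj₁ (l₂⊆ m₂)
    ξX≤ξL : ξ X ≤ ξ (fromList (l₁ ++ l₂))
    ξX≤ξL with proj₁ (isξ (fromList (l₁ ++ l₂)))
    ... | Y , L⊆Y , ηY≡ξL = begin
      ξ X                                 ≤⟨ ξ≤η covered ⟩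
      η ((Y ∪ (X ∩ E₁)) ∪ (X ∩ E₂))       ≤⟨ η₂≤⇒η≤ 0 (S₂.η-∪-spanned (Y ∪ (X ∩ E₁)) proj₂
                                               (λ m → inj₁ (L⊆Y (∈-++⁺ʳ l₁ m))) l₂⊆ (≤-reflexive (sym rk-l₂))) ⟩
      η (Y ∪ (X ∩ E₁))                    ≤⟨ S₁.η-∪-spanned Y proj₂ (λ m → L⊆Y (∈-++⁺ˡ m)) l₁⊆ (≤-reflexive (sym rk-l₁)) ⟩
      η Y                                 ≡⟨ ηY≡ξL ⟩
      ξ (fromList (l₁ ++ l₂))             ∎
      where
      open ≤-Reasoning
      covered : X ⊆ (Y ∪ (X ∩ E₁)) ∪ (X ∩ E₂)
      covered {x} x∈X with cover x
      ... | inj₁ x∈E₁ = inj₁ (inj₂ (x∈X , x∈E₁))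
      ... | inj₂ x∈E₂ = inj₂ (x∈X , x∈E₂)

  ξ-matroid : (∀ X Y → SubmodPair ξ X Y) → IsFiniteRankMatroid U ξ
  ξ-matroid ξ-submod = record
    { rank-∅        = ξ-∅
    ; rank-mono     = λ X⊆Y _ → ξ-mono X⊆Y
    ; rank-unit     = λ {X} x _ _ → ξ-∪-singleton X x
    ; rank-submod   = λ {X} {Y} _ _ → ξ-submod X Y
    ; rank-finitary = λ {X} _ → ξ-finitary X
    ; rank-finite   = K , λ {X} _ → ≤-trans (ξ≤η (λ x → x)) (η≤K X)
    }

  ξ-restricts : ∀ {Eᵢ rkᵢ} → (∀ X → X ⊆ Eᵢ → η X ≡ rkᵢ X) → (∀ {X Y} → X ⊆ Eᵢ → X ⊆ Y → rkᵢ X ≤ η Y)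
              → RestrictsTo ξ Eᵢ rkᵢ
  ξ-restricts {rkᵢ = rkᵢ} η≡rkᵢ rkᵢ≤η X X⊆Eᵢ with proj₁ (isξ X)
  ... | Y , X⊆Y , ηY≡ξX = ≤-antisym (subst (ξ X ≤_) (η≡rkᵢ X X⊆Eᵢ) (ξ≤η (λ x → x)))
                                    (subst (rkᵢ X ≤_) ηY≡ξX (rkᵢ≤η X⊆Eᵢ X⊆Y))

  ξ↾E₁ : RestrictsTo ξ E₁ rk₁
  ξ↾E₁ = ξ-restricts S₁.η≡rk₁ S₁.rk₁≤η

  ξ↾E₂ : RestrictsTo ξ E₂ rk₂
  ξ↾E₂ = ξ-restricts (λ X X⊆E₂ → trans (sym (η-swap X)) (S₂.η≡rk₁ X X⊆E₂))
                     (λ {X} {Y} X⊆E₂ X⊆Y → subst (rk₂ X ≤_) (η-swap Y) (S₂.rk₁≤η X⊆E₂ X⊆Y))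

theorem15 : {E : Set} (E₁ E₂ : Subset E) (rk rk₁ rk₂ : Subset E → ℕ)
    → Countable E
    → (∀ x → E₁ x ⊎ E₂ x)
    → IsFiniteRankMatroid (E₁ ∩ E₂) rk
    → IsFiniteRankMatroid E₁ rk₁
    → IsFiniteRankMatroid E₂ rk₂
    → RestrictsTo rk₁ (E₁ ∩ E₂) rk
    → RestrictsTo rk₂ (E₁ ∩ E₂) rk
    → (ξ : Subset E → ℕ)
    → Amalgam.IsXi E₁ E₂ rk rk₁ rk₂ ξ
    → (∀ X Y → Amalgam.InL E₁ E₂ rk rk₁ rk₂ X → Amalgam.InL E₁ E₂ rk rk₁ rk₂ Y
    → SubmodPair (Amalgam.η E₁ E₂ rk rk₁ rk₂) X Y ⊎ SubmodPair ξ X Y)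
    → (∀ X Y → SubmodPair ξ X Y)
    × IsFiniteRankMatroid U ξ
    × RestrictsTo ξ E₁ rk₁
    × RestrictsTo ξ E₂ rk₂
theorem15 E₁ E₂ rk rk₁ rk₂ _ cover M M₁ M₂ rk₁↾T rk₂↾T ξ isξ hyp =
  ξ-submod , ξ-matroid ξ-submod , ξ↾E₁ , ξ↾E₂
  where
  open Amalgamation E₁ E₂ rk rk₁ rk₂ cover M M₁ M₂ rk₁↾T rk₂↾T ξ isξ
  ξ-submod : ∀ X Y → SubmodPair ξ X Y
  ξ-submod = ξ-submodular hyp
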